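{- Let $p$ be an odd prime, $n\ge0$ and $j\ge0$ integers with $1\le 2j+1<p^{n+1}$. Then \[ \operatorname{ord}_p\binom{ -\frac12}{j}\le n-\operatorname{ord}_p(2j+1). \]
   Context: For $x\in\mathbb Q^\times$, $\operatorname{ord}_px$ is the exponent of $p$ in $x$, i.e. $x=\pm\prod_pp^{\operatorname{ord}_px}$. -}

module Defs where

open import Data.Nat as ℕ using (ℕ; zero; suc)
open import Data.Nat.Divisibility using (_∣?_)
open import Data.Nat.DivMod using (_/_)
open import Data.Integer as ℤ using (ℤ; +_; -[1+_])
open import Data.Rational as ℚ using (ℚ; ↥_; ↧ₙ_)
open import Relation.Nullary using (yes; no)

-- Computed by repeatedly dividing by p,
-- with fuel m (enough since each step divides m by p ≥ 2).
-- Conventions for degenerate inputs (p ≤ 1 or m = 0) give 0.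
ordℕ-go : ℕ → ℕ → ℕ → ℕ
ordℕ-go zero    p m = zero
ordℕ-go (suc f) zero m = zero
ordℕ-go (suc f) (suc zero) m = zero
ordℕ-go (suc f) (suc (suc q)) zero = zero
ordℕ-go (suc f) (suc (suc q)) (suc m) with suc (suc q) ∣? suc m
... | yes _ = suc (ordℕ-go f (suc (suc q)) (suc m / suc (suc q)))
... | no  _ = zero

ordℕ : ℕ → ℕ → ℕ
ordℕ p m = ordℕ-go m p m

ordℚ : ℕ → ℚ → ℤ
ordℚ p x = (+ ordℕ p ℤ.∣ ↥ x ∣) ℤ.- (+ ordℕ p (↧ₙ x))

-- Generalized binomial coefficient  binom(x, j) = x(x-1)...(x-j+1)/j!
-- via binom(x,0) = 1, binom(x, j+1) = binom(x, j) * (x - j) / (j+1).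
genBinom : ℚ → ℕ → ℚ
genBinom x zero    = ℚ.1ℚ
genBinom x (suc j) = genBinom x j ℚ.* ((x ℚ.- ((+ j) ℚ./ 1)) ℚ.* ((+ 1) ℚ./ suc j))

-½ : ℚ
-½ = -[1+ 0 ] ℚ./ 2

module Submission where

-- Since binom(−1/2, j) = (−1)^j · 1·3⋯(2j−1) / (2^j · j!), for odd p its p-adic valuation is
-- Σ_{k<j} ord_p(2k+1) − Σ_{k<j} ord_p(k+1).  For 0 < m < p^(n+1) we have
-- ord_p m = Σ_{i<n} [p^(i+1) ∣ m]; exchanging the sums, the theorem reduces to the fact
-- that for every odd q = 2t+1 the number of multiples of q among 1, 3, …, 2j+1 exceeds the
-- number of multiples of q among 1, …, j by at most one.  Indeed the two counts are
-- ⌊(j+t+1)/q⌋ and ⌊j/q⌋, because q ∣ 2k+1 iff q ∣ k+t+1.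

open import Defs
open import Data.Bool.Base using (if_then_else_)
open import Data.Fin.Base using (toℕ; inject₁; fromℕ)
open import Data.Fin.Properties using (toℕ<n; toℕ-inject₁; toℕ-fromℕ)
open import Data.Integer.Base as ℤ using (ℤ; +_; -[1+_]; _⊖_)
import Data.Integer.Properties as ℤ
import Data.Integer.Tactic.RingSolver as ℤ
open import Data.Nat.Base as ℕ using (ℕ; zero; suc; _+_; _*_; _^_; _≤_; _<_; s≤s; z≤n; NonZero; ≢-nonZero)
open import Data.Nat.Divisibility
  using ( _∣_; _∣?_; ∣⇒≤; divides; _∣0; n∣m*n; m∣m*n; ∣n⇒∣m*n; ∣-refl; ∣-trans; ∣-reflexive
        ; ∣m∣n⇒∣m+n; ∣m+n∣m⇒∣n; *-monoˡ-∣; *-cancelʳ-∣)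
open import Data.Nat.DivMod
  using ( _/_; _%_; m/n<m; m*n/n≡m; m%n<n; m≡m%n+[m/n]*n; m<n⇒m/n≡0; n/n≡1
        ; +-distrib-/-∣ˡ; +-distrib-/-∣ʳ; /-monoˡ-≤)
open import Data.Nat.Induction using (<-wellFounded)
open import Data.Nat.Primality using (Prime; euclidsLemma; prime⇒irreducible; ¬prime[0]; ¬prime[1])
open import Data.Nat.Properties
open import Data.Nat.Tactic.RingSolver using (solve-∀)
open import Data.Product using (∃-syntax; ∃₂; _×_; _,_)
open import Data.Rational.Base as ℚ using (mkℚ; toℚᵘ)
open import Data.Rational.Properties using (toℚᵘ-homo-*; toℚᵘ-homo-+; toℚᵘ-homo‿-; toℚᵘ-fromℚᵘ)
open import Data.Rational.Unnormalised.Base as ℚᵘ using (ℚᵘ; mkℚᵘ; _≃_; *≡*)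
import Data.Rational.Unnormalised.Properties as ℚᵘ
open import Data.Sum using (_⊎_; inj₁; inj₂; [_,_]′)
open import Function.Base using (_∘_)
open import Function.Bundles using (_⇔_; mk⇔)
open import Induction.WellFounded using (Acc; acc)
open import Relation.Binary.PropositionalEquality
open import Relation.Nullary using (does; ¬_; yes; no; contradiction)
open import Relation.Nullary.Decidable using (does-⇔; dec-true; dec-false)

open import Algebra.Properties.CommutativeSemigroup *-commutativeSemigroup using (interchange)
open import Algebra.Properties.CommutativeMonoid.Sum +-0-commutativeMonoid
  using (sum-syntax; sum-cong-≗; sum-init-last; sum-replicate-zero; ∑-comm; ∑-distrib-+)

𝟙[_∣_] : ℕ → ℕ → ℕ
𝟙[ d ∣ n ] = if does (d ∣? n) then 1 else 0

𝟙[∣]-⇔ : ∀ {d n d′ n′} → d ∣ n ⇔ d′ ∣ n′ → 𝟙[ d ∣ n ] ≡ 𝟙[ d′ ∣ n′ ]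
𝟙[∣]-⇔ d∣n⇔d′∣n′ = cong (if_then 1 else 0) (does-⇔ d∣n⇔d′∣n′ (_ ∣? _) (_ ∣? _))

𝟙[∣]-yes : ∀ {d n} → d ∣ n → 𝟙[ d ∣ n ] ≡ 1
𝟙[∣]-yes d∣n = cong (if_then 1 else 0) (dec-true (_ ∣? _) d∣n)

𝟙[∣]-no : ∀ {d n} → ¬ d ∣ n → 𝟙[ d ∣ n ] ≡ 0
𝟙[∣]-no d∤n = cong (if_then 1 else 0) (dec-false (_ ∣? _) d∤n)

∑< : ℕ → (ℕ → ℕ) → ℕ
∑< n f = ∑[ i < n ] f (toℕ i)

∑<-cong : ∀ n {f g : ℕ → ℕ} → (∀ k → k < n → f k ≡ g k) → ∑< n f ≡ ∑< n g
∑<-cong n f≡g = sum-cong-≗ {n} (λ i → f≡g (toℕ i) (toℕ<n i))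

∑<-last : ∀ n (f : ℕ → ℕ) → ∑< (suc n) f ≡ ∑< n f + f n
∑<-last n f = begin
  ∑< (suc n) f                                       ≡⟨ sum-init-last {n} (f ∘ toℕ) ⟩
  ∑[ i < n ] f (toℕ (inject₁ i)) + f (toℕ (fromℕ n))
    ≡⟨ cong₂ _+_ (sum-cong-≗ {n} (cong f ∘ toℕ-inject₁)) (cong f (toℕ-fromℕ n)) ⟩
  ∑< n f + f n                                       ∎
  where open ≡-Reasoning

∑<-comm : ∀ m n (f : ℕ → ℕ → ℕ) → ∑< m (λ k → ∑< n (λ i → f i k)) ≡ ∑< n (λ i → ∑< m (f i))
∑<-comm m n f = ∑-comm {m} {n} (λ k i → f (toℕ i) (toℕ k))

∑<-mono-≤ : ∀ n {f g : ℕ → ℕ} → (∀ k → f k ≤ g k) → ∑< n f ≤ ∑< n g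
∑<-mono-≤ zero    f≤g = ≤-refl
∑<-mono-≤ (suc n) f≤g = +-mono-≤ (f≤g 0) (∑<-mono-≤ n (f≤g ∘ suc))

∑<-suc : ∀ n (f : ℕ → ℕ) → ∑< n (suc ∘ f) ≡ n + ∑< n f
∑<-suc n f = trans (∑-distrib-+ {n} (λ _ → 1) (f ∘ toℕ)) (cong (_+ ∑< n f) (∑<-1 n))
  where
  ∑<-1 : ∀ n → ∑< n (λ _ → 1) ≡ n
  ∑<-1 zero    = refl
  ∑<-1 (suc n) = cong suc (∑<-1 n)

+-−-cross-≤ : ∀ a b c d → a + d ≤ c + b → + a ℤ.- + b ℤ.≤ + c ℤ.- + d
+-−-cross-≤ a b c d a+d≤c+b = begin
  + a ℤ.- + b         ≡⟨ ℤ.[+m]-[+n]≡m⊖n a b ⟩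
  a ⊖ b               ≡⟨ ℤ.+-cancelˡ-⊖ d a b ⟨
  (d + a) ⊖ (d + b)   ≤⟨ ℤ.⊖-monoˡ-≤ (d + b) (subst₂ _≤_ (+-comm a d) (+-comm c b) a+d≤c+b) ⟩
  (b + c) ⊖ (d + b)   ≡⟨ cong ((b + c) ⊖_) (+-comm d b) ⟩
  (b + c) ⊖ (b + d)   ≡⟨ ℤ.+-cancelˡ-⊖ b c d ⟩
  c ⊖ d               ≡⟨ ℤ.[+m]-[+n]≡m⊖n c d ⟨
  + c ℤ.- + d         ∎
  where open ℤ.≤-Reasoning

+-−-cross-≡ : ∀ a b c d → a + d ≡ c + b → + a ℤ.- + b ≡ + c ℤ.- + d
+-−-cross-≡ a b c d a+d≡c+b = ℤ.≤-antisym (+-−-cross-≤ a b c d (≤-reflexive a+d≡c+b))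
                                          (+-−-cross-≤ c d a b (≤-reflexive (sym a+d≡c+b)))

+-−-interchange : ∀ a b c d → + (a + c) ℤ.- + (b + d) ≡ (+ a ℤ.- + b) ℤ.+ (+ c ℤ.- + d)
+-−-interchange a b c d rewrite ℤ.pos-+ a c | ℤ.pos-+ b d = interchange′ (+ a) (+ b) (+ c) (+ d)
  where
  interchange′ : ∀ a b c d → (a ℤ.+ c) ℤ.- (b ℤ.+ d) ≡ (a ℤ.- b) ℤ.+ (c ℤ.- d)
  interchange′ = ℤ.solve-∀

[r+kn]/n≡k : ∀ {r} k n .{{_ : NonZero n}} → r < n → (r + k * n) / n ≡ k
[r+kn]/n≡k {r} k n r<n = trans (+-distrib-/-∣ʳ r (n∣m*n k)) (cong₂ _+_ (m<n⇒m/n≡0 r<n) (m*n/n≡m k n))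

[1+m]/n≡m/n+𝟙[n∣1+m] : ∀ m n .{{_ : NonZero n}} → suc m / n ≡ m / n + 𝟙[ n ∣ suc m ]
[1+m]/n≡m/n+𝟙[n∣1+m] m n@(suc _) with n ∣? suc m
... | yes (divides zero ())
... | yes n∣1+m@(divides (suc c) 1+m≡[1+c]n) = begin
  suc m / n              ≡⟨ cong (_/ n) 1+m≡[1+c]n ⟩
  suc c * n / n          ≡⟨ m*n/n≡m (suc c) n ⟩
  suc c                  ≡⟨ +-comm 1 c ⟩
  c + 1                  ≡⟨ cong₂ _+_ m/n≡c (𝟙[∣]-yes n∣1+m) ⟨
  m / n + 𝟙[ n ∣ suc m ] ∎
  where
  open ≡-Reasoning
  m/n≡c : m / n ≡ c
  m/n≡c = trans (cong (_/ n) (suc-injective 1+m≡[1+c]n)) ([r+kn]/n≡k c n ≤-refl)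
... | no n∤1+m = begin
  suc m / n                     ≡⟨ cong (λ x → suc x / n) (m≡m%n+[m/n]*n m n) ⟩
  (suc (m % n) + m / n * n) / n ≡⟨ [r+kn]/n≡k (m / n) n 1+m%n<n ⟩
  m / n                         ≡⟨ trans (cong (_+_ (m / n)) (𝟙[∣]-no n∤1+m)) (+-identityʳ (m / n)) ⟨
  m / n + 𝟙[ n ∣ suc m ]        ∎
  where
  open ≡-Reasoning
  1+m%n<n : suc (m % n) < n
  1+m%n<n = ≤∧≢⇒< (m%n<n m n) λ 1+m%n≡n → n∤1+m (divides (suc (m / n))
    (trans (cong suc (m≡m%n+[m/n]*n m n)) (cong (_+ m / n * n) 1+m%n≡n)))

∑<-𝟙[∣]-window : ∀ q .{{_ : NonZero q}} a m → a / q + ∑< m (λ k → 𝟙[ q ∣ suc (a + k) ]) ≡ (a + m) / q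
∑<-𝟙[∣]-window q a zero    = trans (+-identityʳ (a / q)) (sym (cong (_/ q) (+-identityʳ a)))
∑<-𝟙[∣]-window q a (suc m) = begin
  a / q + (𝟙[ q ∣ suc (a + 0) ] + ∑< m (λ k → 𝟙[ q ∣ suc (a + suc k) ]))
    ≡⟨ cong₂ (λ x y → a / q + (𝟙[ q ∣ suc x ] + y)) (+-identityʳ a) shift ⟩
  a / q + (𝟙[ q ∣ suc a ] + rest) ≡⟨ +-assoc (a / q) 𝟙[ q ∣ suc a ] rest ⟨
  a / q + 𝟙[ q ∣ suc a ] + rest   ≡⟨ cong (_+ rest) ([1+m]/n≡m/n+𝟙[n∣1+m] a q) ⟨
  suc a / q + rest                ≡⟨ ∑<-𝟙[∣]-window q (suc a) m ⟩
  (suc a + m) / q                 ≡⟨ cong (_/ q) (+-suc a m) ⟨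
  (a + suc m) / q                 ∎
  where
  open ≡-Reasoning
  rest = ∑< m (λ k → 𝟙[ q ∣ suc (suc a + k) ])
  shift : ∑< m (λ k → 𝟙[ q ∣ suc (a + suc k) ]) ≡ rest
  shift = ∑<-cong m {λ k → 𝟙[ q ∣ suc (a + suc k) ]} (λ k _ → cong (λ x → 𝟙[ q ∣ suc x ]) (+-suc a k))

Odd : ℕ → Set
Odd m = ∃[ t ] m ≡ suc (2 * t)

odd-* : ∀ {m n} → Odd m → Odd n → Odd (m * n)
odd-* (s , refl) (t , refl) = s + t + 2 * s * t , product s t
  where
  product : ∀ s t → suc (2 * s) * suc (2 * t) ≡ suc (2 * (s + t + 2 * s * t))
  product = solve-∀

odd-^ : ∀ {m} → Odd m → ∀ k → Odd (m ^ k)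
odd-^ odd-m zero    = 0 , refl
odd-^ odd-m (suc k) = odd-* odd-m (odd-^ odd-m k)

odd-prime : ∀ {p} → Prime p → p ≢ 2 → Odd p
odd-prime {p} pr p≢2 with even⊎odd p
  where
  even⊎odd : ∀ m → (∃[ t ] m ≡ 2 * t) ⊎ Odd m
  even⊎odd zero    = inj₁ (0 , refl)
  even⊎odd (suc m) with even⊎odd m
  ... | inj₁ (t , refl) = inj₂ (t , refl)
  ... | inj₂ (t , refl) = inj₁ (suc t , sym (+-suc (suc t) (t + 0)))
... | inj₂ odd-p      = odd-p
... | inj₁ (t , p≡2t) with prime⇒irreducible pr (divides t (trans p≡2t (*-comm 2 t)))
...   | inj₁ ()
...   | inj₂ 2≡p = contradiction (sym 2≡p) p≢2

odd∣2*⇒∣ : ∀ {t x} → suc (2 * t) ∣ 2 * x → suc (2 * t) ∣ x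
odd∣2*⇒∣ {t} {x} q∣2x =
  ∣m+n∣m⇒∣n (subst (suc (2 * t) ∣_) (expand t x) (∣n⇒∣m*n (suc t) q∣2x)) (n∣m*n x)
  where
  expand : ∀ t x → suc t * (2 * x) ≡ x * suc (2 * t) + x
  expand = solve-∀

odd∣1+2k⇔∣1+t+k : ∀ t k → suc (2 * t) ∣ suc (2 * k) ⇔ suc (2 * t) ∣ suc (t + k)
odd∣1+2k⇔∣1+t+k t k = mk⇔
  (λ q∣1+2k → odd∣2*⇒∣ {t} (subst (suc (2 * t) ∣_) (q+[1+2k] t k) (∣m∣n⇒∣m+n ∣-refl q∣1+2k)))
  (λ q∣1+t+k → ∣m+n∣m⇒∣n (subst (suc (2 * t) ∣_) (sym (q+[1+2k] t k)) (∣n⇒∣m*n 2 q∣1+t+k)) ∣-refl)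
  where
  q+[1+2k] : ∀ t k → suc (2 * t) + suc (2 * k) ≡ 2 * suc (t + k)
  q+[1+2k] = solve-∀

∑<-𝟙[∣1+2k]-≤ : ∀ {q} → Odd q → ∀ j →
                ∑< (suc j) (λ k → 𝟙[ q ∣ suc (2 * k) ]) ≤ suc (∑< j (λ k → 𝟙[ q ∣ suc k ]))
∑<-𝟙[∣1+2k]-≤ {q} (t , refl) j = begin
  ∑< (suc j) (λ k → 𝟙[ q ∣ suc (2 * k) ])
    ≡⟨ ∑<-cong (suc j) {g = λ k → 𝟙[ q ∣ suc (t + k) ]} (λ k _ → 𝟙[∣]-⇔ (odd∣1+2k⇔∣1+t+k t k)) ⟩
  ∑< (suc j) (λ k → 𝟙[ q ∣ suc (t + k) ])
    ≡⟨ cong (_+ ∑< (suc j) (λ k → 𝟙[ q ∣ suc (t + k) ])) (m<n⇒m/n≡0 t<q) ⟨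
  t / q + ∑< (suc j) (λ k → 𝟙[ q ∣ suc (t + k) ])
    ≡⟨ ∑<-𝟙[∣]-window q t (suc j) ⟩
  (t + suc j) / q
    ≤⟨ /-monoˡ-≤ q (subst (_≤ q + j) (sym (+-suc t j)) (+-monoˡ-≤ j t<q)) ⟩
  (q + j) / q
    ≡⟨ trans (+-distrib-/-∣ˡ j ∣-refl) (cong (_+ j / q) (n/n≡1 q)) ⟩
  suc (j / q)
    ≡⟨ cong suc (∑<-𝟙[∣]-window q 0 j) ⟨
  suc (0 / q + ∑< j (λ k → 𝟙[ q ∣ suc k ]))
    ∎
  where
  open ≤-Reasoning
  t<q : t < q
  t<q = s≤s (m≤m+n t (t + 0))

-- The statements about ordℕ p write p as 2 + r: this is the shape on which ordℕ-go computes.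
[1+m]/p≤m : ∀ {r} m → suc m / (2 + r) ≤ m
[1+m]/p≤m {r} m = ≤-pred (m/n<m (suc m) (2 + r) (s≤s (s≤s z≤n)))

ordℕ-go-fuel : ∀ {r} f g m → m ≤ f → m ≤ g → ordℕ-go f (2 + r) m ≡ ordℕ-go g (2 + r) m
ordℕ-go-fuel zero    zero    _       _         _         = refl
ordℕ-go-fuel zero    (suc g) zero    _         _         = refl
ordℕ-go-fuel (suc f) zero    zero    _         _         = refl
ordℕ-go-fuel (suc f) (suc g) zero    _         _         = refl
ordℕ-go-fuel {r} (suc f) (suc g) (suc m) (s≤s m≤f) (s≤s m≤g) with 2 + r ∣? suc m
... | yes _ = cong suc (ordℕ-go-fuel f g _ (≤-trans ([1+m]/p≤m m) m≤f) (≤-trans ([1+m]/p≤m m) m≤g))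
... | no  _ = refl

ordℕ-∣ : ∀ {r m} → 2 + r ∣ suc m → ordℕ (2 + r) (suc m) ≡ suc (ordℕ (2 + r) (suc m / (2 + r)))
ordℕ-∣ {r} {m} p∣m with 2 + r ∣? suc m
... | yes _   = cong suc (ordℕ-go-fuel m _ _ ([1+m]/p≤m m) ≤-refl)
... | no  p∤m = contradiction p∣m p∤m

ordℕ-∤ : ∀ {r} m → ¬ 2 + r ∣ m → ordℕ (2 + r) m ≡ 0
ordℕ-∤     zero    _   = refl
ordℕ-∤ {r} (suc m) p∤m with 2 + r ∣? suc m
... | yes p∣m = contradiction p∣m p∤m
... | no  _   = refl

ordℕ-*p : ∀ {r} m .{{_ : NonZero m}} → ordℕ (2 + r) (m * (2 + r)) ≡ suc (ordℕ (2 + r) m)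
ordℕ-*p {r} m@(suc _) = trans (ordℕ-∣ (n∣m*n m)) (cong (suc ∘ ordℕ (2 + r)) (m*n/n≡m m (2 + r)))

ordℕ-^* : ∀ {r u} k → ¬ 2 + r ∣ u → ordℕ (2 + r) ((2 + r) ^ k * u) ≡ k
ordℕ-^* {r} {u} zero    p∤u = trans (cong (ordℕ (2 + r)) (*-identityˡ u)) (ordℕ-∤ u p∤u)
ordℕ-^* {r} {u} (suc k) p∤u = begin
  ordℕ p (p ^ suc k * u)   ≡⟨ cong (ordℕ p) (trans (*-assoc p (p ^ k) u) (*-comm p (p ^ k * u))) ⟩
  ordℕ p (p ^ k * u * p)   ≡⟨ ordℕ-*p (p ^ k * u) {{m*n≢0 (p ^ k) u {{m^n≢0 p k}} {{u≢0}}}} ⟩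
  suc (ordℕ p (p ^ k * u)) ≡⟨ cong suc (ordℕ-^* k p∤u) ⟩
  suc k                    ∎
  where
  open ≡-Reasoning
  p = 2 + r
  u≢0 : NonZero u
  u≢0 = ≢-nonZero λ { refl → p∤u (p ∣0) }

p^k*u-split : ∀ {r} m .{{_ : NonZero m}} → Acc _<_ m → ∃₂ λ k u → ¬ 2 + r ∣ u × m ≡ (2 + r) ^ k * u
p^k*u-split {r} m (acc rs) with 2 + r ∣? m
... | no  p∤m = 0 , m , p∤m , sym (*-identityˡ m)
... | yes (divides q refl) with p^k*u-split {r} q {{q≢0}} (rs (m<m*n q (2 + r) {{q≢0}} (s≤s (s≤s z≤n))))
  where q≢0 = m*n≢0⇒m≢0 q
...   | k , u , p∤u , refl =
  suc k , u , p∤u , trans (*-comm ((2 + r) ^ k * u) (2 + r)) (sym (*-assoc (2 + r) ((2 + r) ^ k) u))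

ordℕ-* : ∀ {r} → Prime (2 + r) → ∀ m n .{{_ : NonZero m}} .{{_ : NonZero n}} →
         ordℕ (2 + r) (m * n) ≡ ordℕ (2 + r) m + ordℕ (2 + r) n
ordℕ-* {r} pr m n with p^k*u-split {r} m (<-wellFounded m) | p^k*u-split {r} n (<-wellFounded n)
... | k , u , p∤u , refl | l , v , p∤v , refl = begin
  ordℕ p (p ^ k * u * (p ^ l * v))        ≡⟨ cong (ordℕ p) (interchange (p ^ k) u (p ^ l) v) ⟩
  ordℕ p (p ^ k * p ^ l * (u * v))        ≡⟨ cong (λ x → ordℕ p (x * (u * v))) (^-distribˡ-+-* p k l) ⟨
  ordℕ p (p ^ (k + l) * (u * v))          ≡⟨ ordℕ-^* (k + l) ([ p∤u , p∤v ]′ ∘ euclidsLemma u v pr) ⟩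
  k + l                                   ≡⟨ cong₂ _+_ (ordℕ-^* k p∤u) (ordℕ-^* l p∤v) ⟨
  ordℕ p (p ^ k * u) + ordℕ p (p ^ l * v) ∎
  where
  open ≡-Reasoning
  p = 2 + r

ordℕ≡∑𝟙[p^∣] : ∀ {r} n m .{{_ : NonZero m}} → m < (2 + r) ^ suc n →
               ordℕ (2 + r) m ≡ ∑< n (λ i → 𝟙[ (2 + r) ^ suc i ∣ m ])
ordℕ≡∑𝟙[p^∣] {r} n m _ with 2 + r ∣? m
... | no p∤m = begin
  ordℕ (2 + r) m                         ≡⟨ ordℕ-∤ m p∤m ⟩
  0                                      ≡⟨ sum-replicate-zero n ⟨
  ∑< n (λ _ → 0)
    ≡⟨ ∑<-cong n {λ i → 𝟙[ (2 + r) ^ suc i ∣ m ]}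
                 (λ i _ → 𝟙[∣]-no (p∤m ∘ ∣-trans (m∣m*n ((2 + r) ^ i)))) ⟨
  ∑< n (λ i → 𝟙[ (2 + r) ^ suc i ∣ m ]) ∎
  where open ≡-Reasoning
ordℕ≡∑𝟙[p^∣] {r} zero .(q * (2 + r)) qp<p | yes (divides q refl) =
  contradiction (subst (q * (2 + r) <_) (*-identityʳ (2 + r)) qp<p) (≤⇒≯ (m≤n*m (2 + r) q {{m*n≢0⇒m≢0 q}}))
ordℕ≡∑𝟙[p^∣] {r} (suc n) .(q * (2 + r)) qp<p | yes (divides q refl) = begin
  ordℕ p (q * p)                            ≡⟨ ordℕ-*p q {{q≢0}} ⟩
  suc (ordℕ p q)                            ≡⟨ cong suc (ordℕ≡∑𝟙[p^∣] n q {{q≢0}} q<p^n+1) ⟩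
  suc (∑< n (λ i → 𝟙[ p ^ suc i ∣ q ]))
    ≡⟨ cong₂ _+_ (𝟙[∣]-yes p∣qp)
                 (∑<-cong n {λ i → 𝟙[ p ^ suc (suc i) ∣ q * p ]} (λ i _ → 𝟙[∣]-⇔ (shift i))) ⟨
  ∑< (suc n) (λ i → 𝟙[ p ^ suc i ∣ q * p ]) ∎
  where
  open ≡-Reasoning
  p = 2 + r
  q≢0 = m*n≢0⇒m≢0 q
  q<p^n+1 : q < p ^ suc n
  q<p^n+1 = *-cancelʳ-< p q (p ^ suc n) (subst (q * p <_) (*-comm p (p ^ suc n)) qp<p)
  p∣qp : p ^ 1 ∣ q * p
  p∣qp = ∣-trans (∣-reflexive (*-identityʳ p)) (n∣m*n q)
  shift : ∀ i → p ^ suc (suc i) ∣ q * p ⇔ p ^ suc i ∣ q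
  shift i = mk⇔ (*-cancelʳ-∣ p ∘ subst (_∣ q * p) (*-comm p (p ^ suc i)))
                (subst (_∣ q * p) (*-comm (p ^ suc i) p) ∘ *-monoˡ-∣ p)

ordDoubleFactorial : ℕ → ℕ → ℕ
ordDoubleFactorial p j = ∑< j (λ k → ordℕ p (suc (2 * k)))

ordFactorial : ℕ → ℕ → ℕ
ordFactorial p j = ∑< j (λ k → ordℕ p (suc k))

ordDoubleFactorial-≤ : ∀ {r} n j → Odd (2 + r) → suc (2 * j) < (2 + r) ^ suc n →
                       ordDoubleFactorial (2 + r) (suc j) ≤ n + ordFactorial (2 + r) j
ordDoubleFactorial-≤ {r} n j odd-p 1+2j<p^n+1 = begin
  ∑< (suc j) (λ k → ordℕ p (suc (2 * k)))
    ≡⟨ ∑<-cong (suc j) (λ k k≤j → ordℕ≡∑𝟙[p^∣] n _ (1+2k<p^n+1 k k≤j)) ⟩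
  ∑< (suc j) (λ k → ∑< n (λ i → 𝟙[ p ^ suc i ∣ suc (2 * k) ]))
    ≡⟨ ∑<-comm (suc j) n (λ i k → 𝟙[ p ^ suc i ∣ suc (2 * k) ]) ⟩
  ∑< n (λ i → ∑< (suc j) (λ k → 𝟙[ p ^ suc i ∣ suc (2 * k) ]))
    ≤⟨ ∑<-mono-≤ n (λ i → ∑<-𝟙[∣1+2k]-≤ (odd-^ odd-p (suc i)) j) ⟩
  ∑< n (λ i → suc (∑< j (λ k → 𝟙[ p ^ suc i ∣ suc k ])))
    ≡⟨ ∑<-suc n (λ i → ∑< j (λ k → 𝟙[ p ^ suc i ∣ suc k ])) ⟩
  n + ∑< n (λ i → ∑< j (λ k → 𝟙[ p ^ suc i ∣ suc k ]))
    ≡⟨ cong (_+_ n) (∑<-comm j n (λ i k → 𝟙[ p ^ suc i ∣ suc k ])) ⟨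
  n + ∑< j (λ k → ∑< n (λ i → 𝟙[ p ^ suc i ∣ suc k ]))
    ≡⟨ cong (_+_ n) (∑<-cong j (λ k k<j → ordℕ≡∑𝟙[p^∣] n _ (1+k<p^n+1 k k<j))) ⟨
  n + ∑< j (λ k → ordℕ p (suc k))
    ∎
  where
  open ≤-Reasoning
  p = 2 + r
  1+2k<p^n+1 : ∀ k → k < suc j → suc (2 * k) < p ^ suc n
  1+2k<p^n+1 k k≤j = ≤-<-trans (s≤s (*-monoʳ-≤ 2 (≤-pred k≤j))) 1+2j<p^n+1
  1+k<p^n+1 : ∀ k → k < j → suc k < p ^ suc n
  1+k<p^n+1 k k<j = ≤-<-trans (m≤n⇒m≤1+n (≤-trans k<j (m≤n*m j 2))) 1+2j<p^n+1

ordᵘ : ℕ → ℚᵘ → ℤ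
ordᵘ p x = + ordℕ p ℤ.∣ ℚᵘ.↥ x ∣ ℤ.- + ordℕ p (ℚᵘ.↧ₙ x)

ordℚ≡ordᵘ∘toℚᵘ : ∀ p x → ordℚ p x ≡ ordᵘ p (toℚᵘ x)
ordℚ≡ordᵘ∘toℚᵘ p (mkℚ _ _ _) = refl

ordᵘ-cong : ∀ {r x y} → Prime (2 + r) → x ≃ y → .{{_ : ℚᵘ.NonZero y}} →
            ordᵘ (2 + r) x ≡ ordᵘ (2 + r) y
ordᵘ-cong {r} {mkℚᵘ a b} {mkℚᵘ c d} pr (*≡* ad≡cb) =
  +-−-cross-≡ (ordℕ p ℤ.∣ a ∣) (ordℕ p (suc b)) (ordℕ p ℤ.∣ c ∣) (ordℕ p (suc d)) (begin
    ordℕ p ℤ.∣ a ∣ + ordℕ p (suc d) ≡⟨ ordℕ-* pr ℤ.∣ a ∣ (suc d) {{∣a∣≢0}} ⟨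
    ordℕ p (ℤ.∣ a ∣ * suc d)        ≡⟨ cong (ordℕ p) ∣a∣[1+d]≡∣c∣[1+b] ⟩
    ordℕ p (ℤ.∣ c ∣ * suc b)        ≡⟨ ordℕ-* pr ℤ.∣ c ∣ (suc b) ⟩
    ordℕ p ℤ.∣ c ∣ + ordℕ p (suc b) ∎)
  where
  open ≡-Reasoning
  p = 2 + r
  ∣a∣[1+d]≡∣c∣[1+b] : ℤ.∣ a ∣ * suc d ≡ ℤ.∣ c ∣ * suc b
  ∣a∣[1+d]≡∣c∣[1+b] =
    trans (sym (ℤ.abs-* a (+ suc d))) (trans (cong ℤ.∣_∣ ad≡cb) (ℤ.abs-* c (+ suc b)))
  ∣a∣≢0 : NonZero ℤ.∣ a ∣
  ∣a∣≢0 = m*n≢0⇒m≢0 ℤ.∣ a ∣ {{subst NonZero (sym ∣a∣[1+d]≡∣c∣[1+b]) (m*n≢0 ℤ.∣ c ∣ (suc b))}}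

ordᵘ-* : ∀ {r} → Prime (2 + r) → ∀ x y .{{_ : ℚᵘ.NonZero x}} .{{_ : ℚᵘ.NonZero y}} →
         ordᵘ (2 + r) (x ℚᵘ.* y) ≡ ordᵘ (2 + r) x ℤ.+ ordᵘ (2 + r) y
ordᵘ-* {r} pr (mkℚᵘ a b) (mkℚᵘ c d) = begin
  + ordℕ p ℤ.∣ a ℤ.* c ∣ ℤ.- + ordℕ p (suc b * suc d)
    ≡⟨ cong₂ (λ m n → + m ℤ.- + n) (trans (cong (ordℕ p) (ℤ.abs-* a c)) (ordℕ-* pr ℤ.∣ a ∣ ℤ.∣ c ∣))
                                   (ordℕ-* pr (suc b) (suc d)) ⟩
  + (ordℕ p ℤ.∣ a ∣ + ordℕ p ℤ.∣ c ∣) ℤ.- + (ordℕ p (suc b) + ordℕ p (suc d))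
    ≡⟨ +-−-interchange (ordℕ p ℤ.∣ a ∣) (ordℕ p (suc b)) (ordℕ p ℤ.∣ c ∣) (ordℕ p (suc d)) ⟩
  ordᵘ p (mkℚᵘ a b) ℤ.+ ordᵘ p (mkℚᵘ c d)
    ∎
  where
  open ≡-Reasoning
  p = 2 + r

ℚᵘ-*-nonZero : ∀ x y .{{_ : ℚᵘ.NonZero x}} .{{_ : ℚᵘ.NonZero y}} → ℚᵘ.NonZero (x ℚᵘ.* y)
ℚᵘ-*-nonZero (mkℚᵘ a _) (mkℚᵘ c _) = ℤ.i*j≢0 a c

binom-½ᵘ : ℕ → ℚᵘ
binom-½ᵘ zero    = ℚᵘ.1ℚᵘ
binom-½ᵘ (suc j) = binom-½ᵘ j ℚᵘ.* (-[1+ 2 * j ] ℚᵘ./ (2 * suc j))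

binom-½ᵘ-nonZero : ∀ j → ℚᵘ.NonZero (binom-½ᵘ j)
binom-½ᵘ-nonZero zero    = _
binom-½ᵘ-nonZero (suc j) = ℚᵘ-*-nonZero (binom-½ᵘ j) _ {{binom-½ᵘ-nonZero j}}

toℚᵘ-genBinom-½-factor : ∀ j → toℚᵘ ((-½ ℚ.- + j ℚ./ 1) ℚ.* (+ 1 ℚ./ suc j)) ≃
                                  -[1+ 2 * j ] ℚᵘ./ (2 * suc j)
toℚᵘ-genBinom-½-factor j = begin
  toℚᵘ ((-½ ℚ.- + j ℚ./ 1) ℚ.* (+ 1 ℚ./ suc j))
    ≈⟨ toℚᵘ-homo-* (-½ ℚ.- + j ℚ./ 1) (+ 1 ℚ./ suc j) ⟩
  toℚᵘ (-½ ℚ.- + j ℚ./ 1) ℚᵘ.* toℚᵘ (+ 1 ℚ./ suc j)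
    ≈⟨ ℚᵘ.*-cong (ℚᵘ.≃-trans (toℚᵘ-homo-+ -½ (ℚ.- (+ j ℚ./ 1))) (ℚᵘ.+-congʳ (toℚᵘ -½) toℚᵘ[-j]))
                 (toℚᵘ-fromℚᵘ (mkℚᵘ (+ 1) j)) ⟩
  (mkℚᵘ -[1+ 0 ] 1 ℚᵘ.+ ℚᵘ.- mkℚᵘ (+ j) 0) ℚᵘ.* mkℚᵘ (+ 1) j
    ≈⟨ *≡* (cong (ℤ._* + (2 * suc j)) numerator) ⟩
  -[1+ 2 * j ] ℚᵘ./ (2 * suc j)
    ∎
  where
  open ℚᵘ.≃-Reasoning
  toℚᵘ[-j] : toℚᵘ (ℚ.- (+ j ℚ./ 1)) ≃ ℚᵘ.- mkℚᵘ (+ j) 0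
  toℚᵘ[-j] = ℚᵘ.≃-trans (toℚᵘ-homo‿- (+ j ℚ./ 1)) (ℚᵘ.-‿cong (toℚᵘ-fromℚᵘ (mkℚᵘ (+ j) 0)))
  -- both sides have denominator 2 * suc j, so only the numerators need comparing
  numerator : (-[1+ 0 ] ℤ.* + 1 ℤ.+ ℤ.- + j ℤ.* + 2) ℤ.* + 1 ≡ -[1+ 2 * j ]
  numerator = trans (ring (+ j)) (cong (λ x → ℤ.- (+ 1 ℤ.+ x)) (sym (ℤ.pos-* 2 j)))
    where
    ring : ∀ x → (-[1+ 0 ] ℤ.* + 1 ℤ.+ ℤ.- x ℤ.* + 2) ℤ.* + 1 ≡ ℤ.- (+ 1 ℤ.+ + 2 ℤ.* x)
    ring = ℤ.solve-∀

toℚᵘ-genBinom-½ : ∀ j → toℚᵘ (genBinom -½ j) ≃ binom-½ᵘ j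
toℚᵘ-genBinom-½ zero    = ℚᵘ.≃-refl
toℚᵘ-genBinom-½ (suc j) = ℚᵘ.≃-trans (toℚᵘ-homo-* (genBinom -½ j) _)
                                     (ℚᵘ.*-cong (toℚᵘ-genBinom-½ j) (toℚᵘ-genBinom-½-factor j))

ordᵘ-binom-½ᵘ : ∀ {r} → Prime (2 + r) → 2 + r ≢ 2 → ∀ j →
                ordᵘ (2 + r) (binom-½ᵘ j) ≡ + ordDoubleFactorial (2 + r) j ℤ.- + ordFactorial (2 + r) j
ordᵘ-binom-½ᵘ {r} pr p≢2 zero    = ℤ.+-inverseʳ (+ ordℕ (2 + r) 1)
ordᵘ-binom-½ᵘ {r} pr p≢2 (suc j) = begin
  ordᵘ p (binom-½ᵘ j ℚᵘ.* (-[1+ 2 * j ] ℚᵘ./ (2 * suc j)))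
    ≡⟨ ordᵘ-* pr (binom-½ᵘ j) _ {{binom-½ᵘ-nonZero j}} ⟩
  ordᵘ p (binom-½ᵘ j) ℤ.+ (+ ordℕ p (suc (2 * j)) ℤ.- + ordℕ p (2 * suc j))
    ≡⟨ cong₂ (λ x y → x ℤ.+ (+ ordℕ p (suc (2 * j)) ℤ.- + y))
             (ordᵘ-binom-½ᵘ pr p≢2 j) ordℕ[2*[1+j]] ⟩
  (+ D j ℤ.- + F j) ℤ.+ (+ ordℕ p (suc (2 * j)) ℤ.- + ordℕ p (suc j))
    ≡⟨ +-−-interchange (D j) (F j) (ordℕ p (suc (2 * j))) (ordℕ p (suc j)) ⟨
  + (D j + ordℕ p (suc (2 * j))) ℤ.- + (F j + ordℕ p (suc j))
    ≡⟨ cong₂ (λ x y → + x ℤ.- + y) (∑<-last j (λ k → ordℕ p (suc (2 * k))))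
                                   (∑<-last j (λ k → ordℕ p (suc k))) ⟨
  + D (suc j) ℤ.- + F (suc j)
    ∎
  where
  open ≡-Reasoning
  p = 2 + r
  D = ordDoubleFactorial p
  F = ordFactorial p
  p∤2 : ¬ p ∣ 2
  p∤2 p∣2 with ∣⇒≤ p∣2
  ... | s≤s (s≤s z≤n) = p≢2 refl
  ordℕ[2*[1+j]] : ordℕ p (2 * suc j) ≡ ordℕ p (suc j)
  ordℕ[2*[1+j]] = trans (ordℕ-* pr 2 (suc j)) (cong (_+ ordℕ p (suc j)) (ordℕ-∤ 2 p∤2))

ordℚ-genBinom-½ : ∀ {r} → Prime (2 + r) → 2 + r ≢ 2 → ∀ j →
                  ordℚ (2 + r) (genBinom -½ j) ≡ + ordDoubleFactorial (2 + r) j ℤ.- + ordFactorial (2 + r) j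
ordℚ-genBinom-½ {r} pr p≢2 j = begin
  ordℚ p (genBinom -½ j)        ≡⟨ ordℚ≡ordᵘ∘toℚᵘ p (genBinom -½ j) ⟩
  ordᵘ p (toℚᵘ (genBinom -½ j)) ≡⟨ ordᵘ-cong pr (toℚᵘ-genBinom-½ j) {{binom-½ᵘ-nonZero j}} ⟩
  ordᵘ p (binom-½ᵘ j)           ≡⟨ ordᵘ-binom-½ᵘ pr p≢2 j ⟩
  + ordDoubleFactorial p j ℤ.- + ordFactorial p j ∎
  where
  open ≡-Reasoning
  p = 2 + r

lemma3p14 : (p n j : ℕ) → Prime p → p ≢ 2 → 1 ℕ.≤ 2 * j + 1 → 2 * j + 1 < p ^ (suc n) →
    ordℚ p (genBinom -½ j) ℤ.≤ (+ n) ℤ.- (+ ordℕ p (2 * j + 1))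
lemma3p14 zero          _ _ pr = contradiction pr ¬prime[0]
lemma3p14 (suc zero)    _ _ pr = contradiction pr ¬prime[1]
lemma3p14 (suc (suc r)) n j pr p≢2 _ 2j+1<p^n+1 rewrite +-comm (2 * j) 1 = begin
  ordℚ p (genBinom -½ j)                          ≡⟨ ordℚ-genBinom-½ pr p≢2 j ⟩
  + ordDoubleFactorial p j ℤ.- + ordFactorial p j ≤⟨ +-−-cross-≤ _ _ n _ bound ⟩
  + n ℤ.- + ordℕ p (suc (2 * j))                  ∎
  where
  open ℤ.≤-Reasoning
  p = 2 + r
  bound : ordDoubleFactorial p j + ordℕ p (suc (2 * j)) ≤ n + ordFactorial p j
  bound = subst (_≤ n + ordFactorial p j) (∑<-last j (λ k → ordℕ p (suc (2 * k))))
                (ordDoubleFactorial-≤ n j (odd-prime pr p≢2) 2j+1<p^n+1)
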